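{- Let $\Phi$ be a derivation in the CbN type system of $\Gamma\vdash^{(m,e)} s:L$. (1) If $t\to_{m,\mathrm{cbn}} s$ then there is a derivation of $\Gamma\vdash^{(m+1,e)} t:L$. (2) If $t\to_{e,\mathrm{cbn}} s$ then there is a derivation of $\Gamma\vdash^{(m,e+1)} t:L$.
   Context: Terms: $t,s ::= x \mid \lambda x.t \mid t\,s \mid t[x\leftarrow s]$, where $t[x\leftarrow s]$ (explicit substitution) binds $x$ in $t$; usual free variables, terms up to $\alpha$-equivalence. Contexts: substitution contexts $S ::= \langle\cdot\rangle \mid S[x\leftarrow t]$; CbN contexts $C ::= \langle\cdot\rangle \mid C\,t \mid C[x\leftarrow t]$; $C\langle t\rangle$ is plugging (may capture), $C\langle\langle t\rangle\rangle$ plugging where $C$ does not capture free variables of $t$. Root steps: $S\langle\lambda x.t\rangle s\mapsto_m S\langle t[x\leftarrow s]\rangle$ (variables bound by $S$ disjoint from $\mathrm{fv}(s)$); $C\langle\langle x\rangle\rangle[x\leftarrow t]\mapsto_e C\langle\langle t\rangle\rangle[x\leftarrow t]$. $\to_{m,\mathrm{cbn}}$ (resp. $\to_{e,\mathrm{cbn}}$) relates $C\langle t'\rangle$ to $C\langle s'\rangle$ for any CbN context $C$ when $t'\mapsto_m s'$ (resp. $\mapsto_e$). CbN types: linear types $L ::= \mathsf{normal}\mid M\to L$; multi types $M ::= [L_i]_{i\in J}$ finite multisets, $\mathbf 0$ the empty multiset, $\uplus$ union. Type contexts $\Gamma$ map variables to multi types, all but finitely many to $\mathbf 0$; $\mathrm{dom}(\Gamma)=\{x\mid\Gamma(x)\neq\mathbf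 0\}$; $\uplus$ pointwise; $\Gamma,x:M$ means $\Gamma\uplus(x\mapsto M)$ with $x\notin\mathrm{dom}(\Gamma)$; $\Gamma\setminus\!\!\setminus x$ is $\Gamma$ with $x$ mapped to $\mathbf 0$. Rules: (ax) $x:[L]\vdash^{(0,1)} x:L$; (normal) $\vdash^{(0,0)}\lambda x.t:\mathsf{normal}$; (fun) from $\Gamma\vdash^{(m,e)} t:L$ infer $\Gamma\setminus\!\!\setminus x\vdash^{(m,e)}\lambda x.t:\Gamma(x)\to L$; (many) from $\Pi_i\vdash^{(m_i,e_i)} t:L_i$ for $i\in J$ ($J$ finite, possibly empty) infer $\biguplus_i\Pi_i\vdash^{(\sum m_i,\sum e_i)} t:[L_i]_{i\in J}$; (app) from $\Gamma\vdash^{(m,e)} t:M\to L$ and $\Pi\vdash^{(m',e')} s:M$ infer $\Gamma\uplus\Pi\vdash^{(m+m'+1,e+e')} t\,s:L$; (ES) from $\Gamma,x:M\vdash^{(m,e)} t:L$ and $\Pi\vdash^{(m',e')} s:M$ infer $\Gamma\uplus\Pi\vdash^{(m+m',e+e')} t[x\leftarrow s]:L$. -}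

module Defs where

open import Data.Nat using (ℕ; zero; suc; _+_)
open import Data.Fin using (Fin; zero; suc)
open import Data.List using (List; []; _∷_; [_])
import Data.List as List
open import Data.Vec using (Vec; []; _∷_; replicate; zipWith; _[_]≔_)
open import Data.List.Relation.Binary.Permutation.Homogeneous using (Permutation)
open import Data.Vec.Relation.Binary.Pointwise.Inductive using (Pointwise)

-- Terms, up to α-equivalence: well-scoped de Bruijn terms.
-- Tm n = terms whose free variables are among the n de Bruijn indices.
--   var x        ~ x
--   lam t        ~ λx.t          (t : Tm (suc n), index 0 is x)
--   app t s      ~ t s
--   t ⟦ s ⟧      ~ t[x←s]        (t : Tm (suc n), index 0 is x; s : Tm n)

data Tm (n : ℕ) : Set where
  var : Fin n → Tm n
  lam : Tm (suc n) → Tm n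
  app : Tm n → Tm n → Tm n
  _⟦_⟧ : Tm (suc n) → Tm n → Tm n

ext : ∀ {n m} → (Fin n → Fin m) → Fin (suc n) → Fin (suc m)
ext ρ zero    = zero
ext ρ (suc x) = suc (ρ x)

rename : ∀ {n m} → (Fin n → Fin m) → Tm n → Tm m
rename ρ (var x)   = var (ρ x)
rename ρ (lam t)   = lam (rename (ext ρ) t)
rename ρ (app t s) = app (rename ρ t) (rename ρ s)
rename ρ (t ⟦ s ⟧) = rename (ext ρ) t ⟦ rename ρ s ⟧

-- Substitution contexts  S ::= ⟨·⟩ | S[x←t]
-- SCtx n h : the whole term lives in scope n, the hole in scope h.

data SCtx : ℕ → ℕ → Set where
  ⟨⟩   : ∀ {n} → SCtx n n
  _[_]ˢ : ∀ {n h} → SCtx (suc n) h → Tm n → SCtx n h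

plugS : ∀ {n h} → SCtx n h → Tm h → Tm n
plugS ⟨⟩        u = u
plugS (S [ t ]ˢ) u = plugS S u ⟦ t ⟧

-- the weakening along the binders of S (used for non-capturing plugging)
wkS : ∀ {n h} → SCtx n h → Fin n → Fin h
wkS ⟨⟩        x = x
wkS (S [ t ]ˢ) x = wkS S (suc x)

data CCtx : ℕ → ℕ → Set where
  ⟨⟩    : ∀ {n} → CCtx n n
  _·ᶜ_  : ∀ {n h} → CCtx n h → Tm n → CCtx n h
  _[_]ᶜ : ∀ {n h} → CCtx (suc n) h → Tm n → CCtx n h

plugC : ∀ {n h} → CCtx n h → Tm h → Tm n
plugC ⟨⟩         u = u
plugC (C ·ᶜ t)   u = app (plugC C u) t
plugC (C [ t ]ᶜ) u = plugC C u ⟦ t ⟧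

wkC : ∀ {n h} → CCtx n h → Fin n → Fin h
wkC ⟨⟩         x = x
wkC (C ·ᶜ t)   x = wkC C x
wkC (C [ t ]ᶜ) x = wkC C (suc x)

-- Root steps.
--  m : S⟨λx.t⟩ s ↦ S⟨t[x←s]⟩   (s is not captured by S: it is weakened along S)
--  e : C⟨⟨x⟩⟩[x←t] ↦ C⟨⟨t⟩⟩[x←t]  (neither x nor fv(t) captured by C)

data _↦m_ {n : ℕ} : Tm n → Tm n → Set where
  dB : ∀ {h} (S : SCtx n h) (t : Tm (suc h)) (s : Tm n) →
       app (plugS S (lam t)) s ↦m plugS S (t ⟦ rename (wkS S) s ⟧)

data _↦e_ {n : ℕ} : Tm n → Tm n → Set where
  ls : ∀ {h} (C : CCtx (suc n) h) (t : Tm n) →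
       (plugC C (var (wkC C zero)) ⟦ t ⟧) ↦e (plugC C (rename (λ y → wkC C (suc y)) t) ⟦ t ⟧)

-- CbN closure: C⟨t'⟩ → C⟨s'⟩ (plugging may capture)
data _→m-cbn_ {n : ℕ} : Tm n → Tm n → Set where
  ctx : ∀ {h} (C : CCtx n h) {t′ s′ : Tm h} → t′ ↦m s′ → plugC C t′ →m-cbn plugC C s′

data _→e-cbn_ {n : ℕ} : Tm n → Tm n → Set where
  ctx : ∀ {h} (C : CCtx n h) {t′ s′ : Tm h} → t′ ↦e s′ → plugC C t′ →e-cbn plugC C s′

-- CbN types. Multi types (finite multisets) are represented by lists,
-- with multiset equality given by permutation (deeply, see _≈L_ / _≈M_).

data LinTy : Set where
  normal : LinTy
  _⇒_    : List LinTy → LinTy → LinTy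

MultiTy : Set
MultiTy = List LinTy

𝟎 : MultiTy
𝟎 = []

_⊎ᴹ_ : MultiTy → MultiTy → MultiTy
_⊎ᴹ_ = List._++_

data _≈L_ : LinTy → LinTy → Set where
  normal : normal ≈L normal
  _⇒_    : ∀ {M M′ L L′} → Permutation _≈L_ M M′ → L ≈L L′ → (M ⇒ L) ≈L (M′ ⇒ L′)

_≈M_ : MultiTy → MultiTy → Set
_≈M_ = Permutation _≈L_

-- Type contexts for terms in Tm n: one multi type per variable in scope
-- (variables out of scope are implicitly mapped to 𝟎).
Ctx : ℕ → Set
Ctx n = Vec MultiTy n

𝟎ᶜ : ∀ {n} → Ctx n
𝟎ᶜ {n} = replicate n 𝟎

_⊎ᶜ_ : ∀ {n} → Ctx n → Ctx n → Ctx n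
_⊎ᶜ_ = zipWith _⊎ᴹ_

_∶ᶜ_ : ∀ {n} → Fin n → MultiTy → Ctx n
x ∶ᶜ M = 𝟎ᶜ [ x ]≔ M

_≈C_ : ∀ {n} → Ctx n → Ctx n → Set
_≈C_ = Pointwise _≈M_

-- Typing derivations  Γ ⊢[ m , e ] t ∶ L  and  Γ ⊢ᴹ[ m , e ] t ∶ M.
-- For a λ / ES binder, the context (M ∷ Γ) of the body gives M = Γ'(x)
-- and Γ = Γ' ∖∖ x.

infix 4 _⊢[_,_]_∶_ _⊢ᴹ[_,_]_∶_

mutual
  data _⊢[_,_]_∶_ {n : ℕ} : Ctx n → ℕ → ℕ → Tm n → LinTy → Set where
    ax     : ∀ (x : Fin n) L → (x ∶ᶜ [ L ]) ⊢[ 0 , 1 ] var x ∶ L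
    normal : ∀ (t : Tm (suc n)) → 𝟎ᶜ ⊢[ 0 , 0 ] lam t ∶ normal
    fun    : ∀ {M Γ m e t L} → (M ∷ Γ) ⊢[ m , e ] t ∶ L →
             Γ ⊢[ m , e ] lam t ∶ (M ⇒ L)
    app    : ∀ {Γ Π m e m′ e′ t s M L} →
             Γ ⊢[ m , e ] t ∶ (M ⇒ L) → Π ⊢ᴹ[ m′ , e′ ] s ∶ M →
             (Γ ⊎ᶜ Π) ⊢[ suc (m + m′) , e + e′ ] app t s ∶ L
    es     : ∀ {Γ Π m e m′ e′ t s M L} →
             (M ∷ Γ) ⊢[ m , e ] t ∶ L → Π ⊢ᴹ[ m′ , e′ ] s ∶ M →
             (Γ ⊎ᶜ Π) ⊢[ m + m′ , e + e′ ] (t ⟦ s ⟧) ∶ L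

  -- rule (many), with the finite family presented as a list
  data _⊢ᴹ[_,_]_∶_ {n : ℕ} : Ctx n → ℕ → ℕ → Tm n → MultiTy → Set where
    []  : ∀ {t} → 𝟎ᶜ ⊢ᴹ[ 0 , 0 ] t ∶ []
    _∷_ : ∀ {Γ Π m e m′ e′ t L M} →
          Γ ⊢[ m , e ] t ∶ L → Π ⊢ᴹ[ m′ , e′ ] t ∶ M →
          (Γ ⊎ᶜ Π) ⊢ᴹ[ m + m′ , e + e′ ] t ∶ (L ∷ M)

module Submission where

-- A derivation of C⟨u⟩ splits into a derivation of the hole
--    content u and the part contributed by C; any other term v typed with
--    the same type as u, in a context agreeing with u's outside the
--    variables C binds, can be put back (lemma cframe).  Substitution
--    contexts S admit such a frame for every type of the hole (sframe).
--  * Root steps.  For  S⟨λx.t⟩ s ↦ S⟨t[x←s]⟩  the (es) rule typing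
--    t[x←s] becomes (fun) + (app), one more m-step (root-m).  For
--    C⟨⟨x⟩⟩[x←t] ↦ C⟨⟨t⟩⟩[x←t]  the derivation of the copy of t is moved
--    into the multi type of x and replaced by an axiom, one more e-step
--    (root-e).
-- Two auxiliary facts are needed: typings are reflected by injective
-- renamings (the copied term is a weakening), and rule (many) is invariant
-- under permutation of the multi type.

open import Defs
open import Data.Nat using (ℕ; suc; _+_)
open import Data.Nat.Properties using (+-assoc; +-commutativeSemigroup)
open import Algebra.Properties.CommutativeSemigroup +-commutativeSemigroup using (xy∙z≈xz∙y; x∙yz≈y∙xz)
open import Data.Nat.Tactic.RingSolver using (solve-∀)
open import Data.Product using (_×_; ∃; ∃₂; _,_)
open import Data.Fin using (Fin; zero; suc; _≟_)
open import Data.Fin.Properties using (suc-injective)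
open import Data.List using (List; []; _∷_; _++_; [_])
open import Data.List.Properties using (++-assoc; ++-identityʳ)
open import Data.Vec using ([]; _∷_; lookup; tail)
open import Data.Vec.Properties using (lookup-zipWith; lookup-replicate; lookup∘update; lookup∘update′)
import Data.List.Relation.Binary.Permutation.Propositional as ↭
open ↭ using (_↭_; ↭-refl; ↭-sym; ↭-trans; ↭-reflexive; ↭⇒↭ₛ; module PermutationReasoning)
open import Data.List.Relation.Binary.Permutation.Propositional.Properties using (++⁺ˡ; ++⁺ʳ; ++⁺; ++-comm; shifts)
import Data.List.Relation.Binary.Permutation.Homogeneous as Homogeneous
import Data.List.Relation.Binary.Pointwise as ListPointwise
import Data.Vec.Relation.Binary.Pointwise.Inductive as VecPointwise
open import Function using (_∘_)
open import Function.Definitions using (Injective)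
open import Relation.Binary.PropositionalEquality hiding ([_])
open import Relation.Nullary using (yes; no)

private
  variable
    n k h : ℕ
    m e m′ e′ : ℕ
    L : LinTy
    M : MultiTy

-- Type contexts as finite maps to multisets

lookup-⊎ᶜ : (Γ Π : Ctx n) (x : Fin n) → lookup (Γ ⊎ᶜ Π) x ≡ lookup Γ x ++ lookup Π x
lookup-⊎ᶜ Γ Π x = lookup-zipWith _++_ x Γ Π

lookup-𝟎ᶜ : (x : Fin n) → lookup (𝟎ᶜ {n}) x ≡ []
lookup-𝟎ᶜ x = lookup-replicate x []

lookup-∶ᶜ-self : (x : Fin n) (M : MultiTy) → lookup (x ∶ᶜ M) x ≡ M
lookup-∶ᶜ-self x M = lookup∘update x 𝟎ᶜ M

lookup-∶ᶜ-other : {x y : Fin n} (M : MultiTy) → x ≢ y → lookup (x ∶ᶜ M) y ≡ []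
lookup-∶ᶜ-other {y = y} M x≢y = trans (lookup∘update′ (x≢y ∘ sym) 𝟎ᶜ M) (lookup-𝟎ᶜ y)

-- the multiset of a variable grows by exactly the type of a new occurrence
↭-gain : {A M′ : MultiTy} → M ↭ A → M′ ↭ A ++ [ L ] → (L ∷ M) ↭ M′
↭-gain {M = M} {L = L} {A} {M′} old new = begin
    L ∷ M       ↭⟨ ↭.prep L old ⟩
    L ∷ A       ↭⟨ ++-comm [ L ] A ⟩
    A ++ [ L ]  ↭⟨ ↭-sym new ⟩
    M′          ∎
  where open PermutationReasoning

infix 4 _≋_
record _≋_ (Γ Γ′ : Ctx n) : Set where
  constructor mk≋
  field un : ∀ x → lookup Γ x ↭ lookup Γ′ x
open _≋_

≋-refl : {Γ : Ctx n} → Γ ≋ Γ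
≋-refl = mk≋ λ _ → ↭-refl

≋-trans : {Γ Γ′ Γ″ : Ctx n} → Γ ≋ Γ′ → Γ′ ≋ Γ″ → Γ ≋ Γ″
≋-trans p q = mk≋ λ x → ↭-trans (un p x) (un q x)

⊎ᶜ-cong : {Γ Γ′ Π Π′ : Ctx n} → Γ ≋ Γ′ → Π ≋ Π′ → (Γ ⊎ᶜ Π) ≋ (Γ′ ⊎ᶜ Π′)
⊎ᶜ-cong {Γ = Γ} {Γ′} {Π} {Π′} p q = mk≋ λ x →
  subst₂ _↭_ (sym (lookup-⊎ᶜ Γ Π x)) (sym (lookup-⊎ᶜ Γ′ Π′ x)) (++⁺ (un p x) (un q x))

lookup-⊎ᶜ³ : (Γ Δ Π : Ctx n) (x : Fin n) →
             lookup (Γ ⊎ᶜ (Δ ⊎ᶜ Π)) x ≡ lookup Γ x ++ (lookup Δ x ++ lookup Π x)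
lookup-⊎ᶜ³ Γ Δ Π x = trans (lookup-⊎ᶜ Γ _ x) (cong (lookup Γ x ++_) (lookup-⊎ᶜ Δ Π x))

⊎ᶜ-swap : (Γ Δ Π : Ctx n) → (Γ ⊎ᶜ (Δ ⊎ᶜ Π)) ≋ (Δ ⊎ᶜ (Γ ⊎ᶜ Π))
⊎ᶜ-swap Γ Δ Π = mk≋ λ x →
  subst₂ _↭_ (sym (lookup-⊎ᶜ³ Γ Δ Π x)) (sym (lookup-⊎ᶜ³ Δ Γ Π x)) (shifts (lookup Γ x) (lookup Δ x))

⊎ᶜ-assoc : (Γ Δ Π : Ctx n) → (Γ ⊎ᶜ (Δ ⊎ᶜ Π)) ≋ ((Γ ⊎ᶜ Δ) ⊎ᶜ Π)
⊎ᶜ-assoc Γ Δ Π = mk≋ λ x → ↭-reflexive (begin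
    lookup (Γ ⊎ᶜ (Δ ⊎ᶜ Π)) x                  ≡⟨ lookup-⊎ᶜ³ Γ Δ Π x ⟩
    lookup Γ x ++ (lookup Δ x ++ lookup Π x)  ≡⟨ sym (++-assoc (lookup Γ x) _ _) ⟩
    (lookup Γ x ++ lookup Δ x) ++ lookup Π x  ≡⟨ cong (_++ lookup Π x) (sym (lookup-⊎ᶜ Γ Δ x)) ⟩
    lookup (Γ ⊎ᶜ Δ) x ++ lookup Π x           ≡⟨ sym (lookup-⊎ᶜ (Γ ⊎ᶜ Δ) Π x) ⟩
    lookup ((Γ ⊎ᶜ Δ) ⊎ᶜ Π) x                  ∎)
  where open ≡-Reasoning

recount : {Γ : Ctx n} {t : Tm n} → m ≡ m′ → e ≡ e′ →
          Γ ⊢[ m , e ] t ∶ L → Γ ⊢[ m′ , e′ ] t ∶ L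
recount refl refl d = d

recountᴹ : {Γ : Ctx n} {t : Tm n} → m ≡ m′ → e ≡ e′ →
           Γ ⊢ᴹ[ m , e ] t ∶ M → Γ ⊢ᴹ[ m′ , e′ ] t ∶ M
recountᴹ refl refl ds = ds

many-perm : ∀ {Π : Ctx n} {s M′} → Π ⊢ᴹ[ m , e ] s ∶ M → M ↭ M′ →
            ∃ λ Π′ → Π′ ≋ Π × Π′ ⊢ᴹ[ m , e ] s ∶ M′
many-perm ds ↭.refl = _ , ≋-refl , ds
many-perm (d ∷ ds) (↭.prep _ p) with many-perm ds p
... | _ , Π′≋Π , ds′ = _ , ⊎ᶜ-cong ≋-refl Π′≋Π , d ∷ ds′
many-perm (_∷_ {Γ = Γ₁} {m = m₁} {e = e₁} d₁ (_∷_ {Γ = Γ₂} {Π = Π} {m = m₂} {e = e₂} {m′ = m₃} {e′ = e₃} d₂ ds))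
          (↭.swap _ _ p) with many-perm ds p
... | _ , Π′≋Π , ds′ =
  _ , ≋-trans (⊎ᶜ-cong ≋-refl (⊎ᶜ-cong ≋-refl Π′≋Π)) (⊎ᶜ-swap Γ₂ Γ₁ Π) ,
  recountᴹ (x∙yz≈y∙xz m₂ m₁ m₃) (x∙yz≈y∙xz e₂ e₁ e₃) (d₂ ∷ (d₁ ∷ ds′))
many-perm ds (↭.trans p q) with many-perm ds p
... | _ , Π₁≋Π , ds₁ with many-perm ds₁ q
... | Π₂ , Π₂≋Π₁ , ds₂ = Π₂ , ≋-trans Π₂≋Π₁ Π₁≋Π , ds₂

-- Injective renamings (weakenings along binders)

OffImage : (Fin k → Fin h) → Fin h → Set
OffImage ρ y = ∀ x → ρ x ≢ y

ext-injective : {ρ : Fin k → Fin h} → Injective _≡_ _≡_ ρ → Injective _≡_ _≡_ (ext ρ)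
ext-injective inj {zero}  {zero}  _  = refl
ext-injective inj {suc x} {suc y} eq = cong suc (inj (suc-injective eq))

ext-offImage : {ρ : Fin k → Fin h} {y : Fin h} → OffImage ρ y → OffImage (ext ρ) (suc y)
ext-offImage off (suc x) eq = off x (suc-injective eq)

wkC-injective : (C : CCtx k h) → Injective _≡_ _≡_ (wkC C)
wkC-injective ⟨⟩         eq = eq
wkC-injective (C ·ᶜ _)   eq = wkC-injective C eq
wkC-injective (C [ _ ]ᶜ) eq = suc-injective (wkC-injective C eq)

wkS-injective : (S : SCtx k h) → Injective _≡_ _≡_ (wkS S)
wkS-injective ⟨⟩         eq = eq
wkS-injective (S [ _ ]ˢ) eq = suc-injective (wkS-injective S eq)

zero-offImage : {w : Fin (suc k) → Fin h} → Injective _≡_ _≡_ w → OffImage (w ∘ suc) (w zero)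
zero-offImage inj x eq with inj eq
... | ()

∶ᶜ-off-image : {ρ : Fin k → Fin h} {y : Fin h} (M : MultiTy) (Δ : Ctx h) → OffImage ρ y →
               ∀ x → lookup ((y ∶ᶜ M) ⊎ᶜ Δ) (ρ x) ≡ lookup Δ (ρ x)
∶ᶜ-off-image {ρ = ρ} {y} M Δ off x = trans (lookup-⊎ᶜ (y ∶ᶜ M) Δ (ρ x)) (cong (_++ lookup Δ _) (lookup-∶ᶜ-other M (off x ∘ sym)))

record Restricts (ρ : Fin k → Fin h) (Π : Ctx h) (Π₀ : Ctx k) : Set where
  constructor mkRestricts
  field restricts-at : ∀ x → lookup Π (ρ x) ≡ lookup Π₀ x
open Restricts

record EmptyOff (ρ : Fin k → Fin h) (Π : Ctx h) : Set where
  constructor mkEmptyOff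
  field empty-at : ∀ y → OffImage ρ y → lookup Π y ≡ []
open EmptyOff

restricts-𝟎ᶜ : (ρ : Fin k → Fin h) → Restricts ρ 𝟎ᶜ 𝟎ᶜ
restricts-𝟎ᶜ ρ = mkRestricts λ x → trans (lookup-𝟎ᶜ (ρ x)) (sym (lookup-𝟎ᶜ x))

restricts-⊎ᶜ : {ρ : Fin k → Fin h} {Γ Π : Ctx h} {Γ₀ Π₀ : Ctx k} →
               Restricts ρ Γ Γ₀ → Restricts ρ Π Π₀ → Restricts ρ (Γ ⊎ᶜ Π) (Γ₀ ⊎ᶜ Π₀)
restricts-⊎ᶜ {ρ = ρ} {Γ} {Π} {Γ₀} {Π₀} (mkRestricts r) (mkRestricts q) = mkRestricts λ x →
  trans (lookup-⊎ᶜ Γ Π (ρ x)) (trans (cong₂ _++_ (r x) (q x)) (sym (lookup-⊎ᶜ Γ₀ Π₀ x)))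

restricts-∶ᶜ : {ρ : Fin k → Fin h} → Injective _≡_ _≡_ ρ →
               (x : Fin k) (M : MultiTy) → Restricts ρ (ρ x ∶ᶜ M) (x ∶ᶜ M)
restricts-∶ᶜ {ρ = ρ} inj x M = mkRestricts at
  where
  at : ∀ z → lookup (ρ x ∶ᶜ M) (ρ z) ≡ lookup (x ∶ᶜ M) z
  at z with z ≟ x
  ... | yes refl = trans (lookup-∶ᶜ-self (ρ x) M) (sym (lookup-∶ᶜ-self x M))
  ... | no z≢x   = trans (lookup-∶ᶜ-other M (z≢x ∘ sym ∘ inj)) (sym (lookup-∶ᶜ-other M (z≢x ∘ sym)))

emptyOff-𝟎ᶜ : (ρ : Fin k → Fin h) → EmptyOff ρ 𝟎ᶜ
emptyOff-𝟎ᶜ ρ = mkEmptyOff λ y _ → lookup-𝟎ᶜ y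

emptyOff-⊎ᶜ : {ρ : Fin k → Fin h} {Γ Π : Ctx h} → EmptyOff ρ Γ → EmptyOff ρ Π → EmptyOff ρ (Γ ⊎ᶜ Π)
emptyOff-⊎ᶜ {Γ = Γ} {Π} (mkEmptyOff r) (mkEmptyOff q) = mkEmptyOff λ y off → trans (lookup-⊎ᶜ Γ Π y) (cong₂ _++_ (r y off) (q y off))

emptyOff-ext : {ρ : Fin k → Fin h} {M : MultiTy} {Π : Ctx h} → EmptyOff (ext ρ) (M ∷ Π) → EmptyOff ρ Π
emptyOff-ext (mkEmptyOff r) = mkEmptyOff λ y off → r (suc y) (ext-offImage off)

mutual
  rename-inversion : (ρ : Fin k → Fin h) → Injective _≡_ _≡_ ρ → ∀ {Π} (s : Tm k) →
    Π ⊢[ m , e ] rename ρ s ∶ L →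
    ∃ λ Π₀ → Π₀ ⊢[ m , e ] s ∶ L × Restricts ρ Π Π₀ × EmptyOff ρ Π
  rename-inversion ρ inj (var x) (ax _ L) =
    x ∶ᶜ [ L ] , ax x L , restricts-∶ᶜ inj x [ L ] , mkEmptyOff λ y off → lookup-∶ᶜ-other [ L ] (off x)
  rename-inversion ρ inj (lam s) (normal _) =
    𝟎ᶜ , normal s , restricts-𝟎ᶜ ρ , emptyOff-𝟎ᶜ ρ
  rename-inversion ρ inj (lam s) (fun d) with binder-inversion ρ inj s d
  ... | Π₀ , d₀ , r , z = Π₀ , fun d₀ , r , z
  rename-inversion ρ inj (app s₁ s₂) (app d₁ d₂)
    with rename-inversion ρ inj s₁ d₁ | rename-inversionᴹ ρ inj s₂ d₂
  ... | Γ₀ , d₁′ , r₁ , z₁ | Π₀ , d₂′ , r₂ , z₂ =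
    Γ₀ ⊎ᶜ Π₀ , app d₁′ d₂′ , restricts-⊎ᶜ r₁ r₂ , emptyOff-⊎ᶜ z₁ z₂
  rename-inversion ρ inj (s₁ ⟦ s₂ ⟧) (es d₁ d₂)
    with binder-inversion ρ inj s₁ d₁ | rename-inversionᴹ ρ inj s₂ d₂
  ... | Γ₀ , d₁′ , r₁ , z₁ | Π₀ , d₂′ , r₂ , z₂ =
    Γ₀ ⊎ᶜ Π₀ , es d₁′ d₂′ , restricts-⊎ᶜ r₁ r₂ , emptyOff-⊎ᶜ z₁ z₂

  binder-inversion : (ρ : Fin k → Fin h) → Injective _≡_ _≡_ ρ → ∀ {Π} (s : Tm (suc k)) →
    (M ∷ Π) ⊢[ m , e ] rename (ext ρ) s ∶ L →
    ∃ λ Π₀ → (M ∷ Π₀) ⊢[ m , e ] s ∶ L × Restricts ρ Π Π₀ × EmptyOff ρ Π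
  binder-inversion ρ inj s d with rename-inversion (ext ρ) (ext-injective inj) s d
  ... | M₀ ∷ Π₀ , d₀ , r , z =
    Π₀ , subst (λ M → (M ∷ Π₀) ⊢[ _ , _ ] s ∶ _) (sym (restricts-at r zero)) d₀ ,
    mkRestricts (restricts-at r ∘ suc) , emptyOff-ext z

  rename-inversionᴹ : (ρ : Fin k → Fin h) → Injective _≡_ _≡_ ρ → ∀ {Π} (s : Tm k) →
    Π ⊢ᴹ[ m , e ] rename ρ s ∶ M →
    ∃ λ Π₀ → Π₀ ⊢ᴹ[ m , e ] s ∶ M × Restricts ρ Π Π₀ × EmptyOff ρ Π
  rename-inversionᴹ ρ inj s [] = 𝟎ᶜ , [] , restricts-𝟎ᶜ ρ , emptyOff-𝟎ᶜ ρ
  rename-inversionᴹ ρ inj s (d ∷ ds) with rename-inversion ρ inj s d | rename-inversionᴹ ρ inj s ds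
  ... | Γ₀ , d′ , r₁ , z₁ | Π₀ , ds′ , r₂ , z₂ =
    Γ₀ ⊎ᶜ Π₀ , d′ ∷ ds′ , restricts-⊎ᶜ r₁ r₂ , emptyOff-⊎ᶜ z₁ z₂

-- Splitting a context between a context C and its hole.
-- Splits w Γ Γᶜ Δ: Γ is Γᶜ (the part typing C) plus the hole context Δ
-- read along the weakening w of C.

record Splits (w : Fin k → Fin h) (Γ Γᶜ : Ctx k) (Δ : Ctx h) : Set where
  constructor mkSplits
  field split-at : ∀ x → lookup Γ x ↭ lookup Γᶜ x ++ lookup Δ (w x)
open Splits

-- Δ′ may replace Δ: they differ only on variables bound by the context
Agree : (Fin k → Fin h) → Ctx h → Ctx h → Set
Agree w Δ′ Δ = ∀ y → OffImage w y → lookup Δ′ y ↭ lookup Δ y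

splits-unit : {Γ : Ctx n} → Splits (λ x → x) Γ 𝟎ᶜ Γ
splits-unit {Γ = Γ} = mkSplits λ x → ↭-reflexive (cong (_++ lookup Γ x) (sym (lookup-𝟎ᶜ x)))

splits-⊎ᶜ : {w : Fin k → Fin h} {Γ Γᶜ Π : Ctx k} {Δ : Ctx h} →
            Splits w Γ Γᶜ Δ → Splits w (Γ ⊎ᶜ Π) (Γᶜ ⊎ᶜ Π) Δ
splits-⊎ᶜ {w = w} {Γ} {Γᶜ} {Π} {Δ} (mkSplits split) = mkSplits λ x → begin
    lookup (Γ ⊎ᶜ Π) x                              ≡⟨ lookup-⊎ᶜ Γ Π x ⟩
    lookup Γ x ++ lookup Π x                       ↭⟨ ++⁺ʳ (lookup Π x) (split x) ⟩
    (lookup Γᶜ x ++ lookup Δ (w x)) ++ lookup Π x  ↭⟨ ↭-reflexive (++-assoc (lookup Γᶜ x) _ _) ⟩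
    lookup Γᶜ x ++ (lookup Δ (w x) ++ lookup Π x)  ↭⟨ ++⁺ˡ (lookup Γᶜ x) (++-comm (lookup Δ (w x)) _) ⟩
    lookup Γᶜ x ++ (lookup Π x ++ lookup Δ (w x))  ↭⟨ ↭-reflexive (sym (++-assoc (lookup Γᶜ x) _ _)) ⟩
    (lookup Γᶜ x ++ lookup Π x) ++ lookup Δ (w x)  ≡⟨ cong (_++ lookup Δ (w x)) (sym (lookup-⊎ᶜ Γᶜ Π x)) ⟩
    lookup (Γᶜ ⊎ᶜ Π) x ++ lookup Δ (w x)           ∎
  where open PermutationReasoning

splits-tail : {w : Fin (suc k) → Fin h} {Γ : Ctx k} {Γᶜ : Ctx (suc k)} {Δ : Ctx h} →
              Splits w (M ∷ Γ) Γᶜ Δ → Splits (w ∘ suc) Γ (tail Γᶜ) Δ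
splits-tail {Γᶜ = _ ∷ _} (mkSplits split) = mkSplits (split ∘ suc)

≋-splits : {w : Fin k → Fin h} {Γ Γ′ Γᶜ : Ctx k} {Δ : Ctx h} →
           Γ′ ≋ Γ → Splits w Γ Γᶜ Δ → Splits w Γ′ Γᶜ Δ
≋-splits Γ′≋Γ (mkSplits split) = mkSplits λ x → ↭-trans (un Γ′≋Γ x) (split x)

splits-restricts : {w : Fin k → Fin h} {Γ Γᶜ Π₀ : Ctx k} {Δ Π : Ctx h} →
                   Splits w Γ Γᶜ Δ → Restricts w Π Π₀ → Splits w (Γ ⊎ᶜ Π₀) Γᶜ (Δ ⊎ᶜ Π)
splits-restricts {w = w} {Γ} {Γᶜ} {Π₀} {Δ} {Π} (mkSplits split) (mkRestricts r) = mkSplits λ x → begin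
    lookup (Γ ⊎ᶜ Π₀) x                              ≡⟨ lookup-⊎ᶜ Γ Π₀ x ⟩
    lookup Γ x ++ lookup Π₀ x                       ↭⟨ ++⁺ʳ (lookup Π₀ x) (split x) ⟩
    (lookup Γᶜ x ++ lookup Δ (w x)) ++ lookup Π₀ x  ≡⟨ ++-assoc (lookup Γᶜ x) _ _ ⟩
    lookup Γᶜ x ++ (lookup Δ (w x) ++ lookup Π₀ x)  ≡⟨ cong (λ P → lookup Γᶜ x ++ (lookup Δ (w x) ++ P)) (sym (r x)) ⟩
    lookup Γᶜ x ++ (lookup Δ (w x) ++ lookup Π (w x)) ≡⟨ cong (lookup Γᶜ x ++_) (sym (lookup-⊎ᶜ Δ Π (w x))) ⟩
    lookup Γᶜ x ++ lookup (Δ ⊎ᶜ Π) (w x)            ∎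
  where open PermutationReasoning

splits-unique : {w : Fin k → Fin h} {Γ Γ′ Γᶜ : Ctx k} {Δ Δ′ : Ctx h} →
                Splits w Γ Γᶜ Δ → Splits w Γ′ Γᶜ Δ′ →
                (∀ x → lookup Δ′ (w x) ↭ lookup Δ (w x)) → Γ′ ≋ Γ
splits-unique {Γᶜ = Γᶜ} (mkSplits split) (mkSplits split′) same = mk≋ λ x →
  ↭-trans (split′ x) (↭-trans (++⁺ˡ (lookup Γᶜ x) (same x)) (↭-sym (split x)))

-- Frames: a derivation of C⟨u⟩ as a derivation of u inside C.

-- the hole of `plug` typed Lᵘ in Δ can be refilled by any v of type Lᵘ
-- whose context Δ′ agrees with Δ outside the variables bound by the frame
Refillable : (Fin k → Fin h) → (Tm h → Tm k) → Ctx k → ℕ → ℕ → Ctx h → LinTy → LinTy → Set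
Refillable w plug Γᶜ mᶜ eᶜ Δ Lᵘ L =
  ∀ {v Δ′ mᵛ eᵛ} → Δ′ ⊢[ mᵛ , eᵛ ] v ∶ Lᵘ → Agree w Δ′ Δ →
  ∃ λ Γ′ → Splits w Γ′ Γᶜ Δ′ × Γ′ ⊢[ mᶜ + mᵛ , eᶜ + eᵛ ] plug v ∶ L

refill-app : {w : Fin k → Fin h} {plug : Tm h → Tm k} {Γᶜ Π : Ctx k} {Δ : Ctx h} {mᶜ eᶜ : ℕ} {r : Tm k} {Lᵘ : LinTy} →
             Π ⊢ᴹ[ m′ , e′ ] r ∶ M → Refillable w plug Γᶜ mᶜ eᶜ Δ Lᵘ (M ⇒ L) →
             Refillable w (λ v → app (plug v) r) (Γᶜ ⊎ᶜ Π) (suc (mᶜ + m′)) (eᶜ + e′) Δ Lᵘ L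
refill-app {m′ = m′} {e′ = e′} {mᶜ = mᶜ} {eᶜ} d₂ refill {mᵛ = mᵛ} {eᵛ} dv agree with refill dv agree
... | Γ′ , split , d₁ =
  Γ′ ⊎ᶜ _ , splits-⊎ᶜ split , recount (cong suc (xy∙z≈xz∙y mᶜ mᵛ m′)) (xy∙z≈xz∙y eᶜ eᵛ e′) (app d₁ d₂)

-- Under an ES the multi type of its variable may change by a permutation
-- (the refilled context agrees with the old one at the image of x), which
-- the argument derivation absorbs by many-perm.
refill-es : {w : Fin (suc k) → Fin h} {plug : Tm h → Tm (suc k)} {Γ : Ctx k} {Γᶜ : Ctx (suc k)} {Π : Ctx k}
            {Δ : Ctx h} {mᶜ eᶜ : ℕ} {r : Tm k} {Lᵘ : LinTy} →
            Injective _≡_ _≡_ w → Π ⊢ᴹ[ m′ , e′ ] r ∶ M → Splits w (M ∷ Γ) Γᶜ Δ →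
            Refillable w plug Γᶜ mᶜ eᶜ Δ Lᵘ L →
            Refillable (w ∘ suc) (λ v → plug v ⟦ r ⟧) (tail Γᶜ ⊎ᶜ Π) (mᶜ + m′) (eᶜ + e′) Δ Lᵘ L
refill-es {m′ = m′} {e′ = e′} {w = w} {Γᶜ = Γᶜ} {mᶜ = mᶜ} {eᶜ} inj d₂ split refill {mᵛ = mᵛ} {eᵛ} dv agree
  with refill dv (λ y off → agree y (off ∘ suc))
... | M′ ∷ Γ′ , split′ , d₁
  with many-perm d₂ (↭-trans (split-at split zero)
                     (↭-trans (++⁺ˡ (lookup Γᶜ zero) (↭-sym (agree (w zero) (zero-offImage inj))))
                              (↭-sym (split-at split′ zero))))
... | Π′ , Π′≋Π , d₂′ =
  Γ′ ⊎ᶜ Π′ , ≋-splits (⊎ᶜ-cong ≋-refl Π′≋Π) (splits-⊎ᶜ (splits-tail split′)) ,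
  recount (xy∙z≈xz∙y mᶜ mᵛ m′) (xy∙z≈xz∙y eᶜ eᵛ e′) (es d₁ d₂′)

record Frame (w : Fin k → Fin h) (Γ : Ctx k) (m e : ℕ) (u : Tm h) (Lᵘ : LinTy)
             (Refill : Ctx k → ℕ → ℕ → Ctx h → Set) : Set where
  constructor frame
  field
    Γᶜ        : Ctx k
    mᶜ eᶜ     : ℕ
    Δ         : Ctx h
    mᵘ eᵘ     : ℕ
    hole      : Δ ⊢[ mᵘ , eᵘ ] u ∶ Lᵘ
    m-split   : m ≡ mᶜ + mᵘ
    e-split   : e ≡ eᶜ + eᵘ
    ctx-split : Splits w Γ Γᶜ Δ
    refill    : Refill Γᶜ mᶜ eᶜ Δ

CbNFrame : CCtx k h → Ctx k → ℕ → ℕ → Tm h → LinTy → Set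
CbNFrame C Γ m e u L =
  ∃ λ Lᵘ → Frame (wkC C) Γ m e u Lᵘ (λ Γᶜ mᶜ eᶜ Δ → Refillable (wkC C) (plugC C) Γᶜ mᶜ eᶜ Δ Lᵘ L)

cframe : (C : CCtx k h) {Γ : Ctx k} {u : Tm h} → Γ ⊢[ m , e ] plugC C u ∶ L → CbNFrame C Γ m e u L
cframe ⟨⟩ d = _ , frame 𝟎ᶜ 0 0 _ _ _ d refl refl splits-unit (λ dv _ → _ , splits-unit , dv)
cframe (C ·ᶜ _) (app {m′ = m′} {e′ = e′} d₁ d₂) with cframe C d₁
... | Lᵘ , frame Γᶜ mᶜ eᶜ Δ mᵘ eᵘ hole refl refl split refill =
  Lᵘ , frame (Γᶜ ⊎ᶜ _) (suc (mᶜ + m′)) (eᶜ + e′) Δ mᵘ eᵘ hole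
             (cong suc (xy∙z≈xz∙y mᶜ mᵘ m′)) (xy∙z≈xz∙y eᶜ eᵘ e′)
             (splits-⊎ᶜ split) (refill-app {Δ = Δ} d₂ refill)
cframe (C [ _ ]ᶜ) (es {m′ = m′} {e′ = e′} d₁ d₂) with cframe C d₁
... | Lᵘ , frame Γᶜ mᶜ eᶜ Δ mᵘ eᵘ hole refl refl split refill =
  Lᵘ , frame (tail Γᶜ ⊎ᶜ _) (mᶜ + m′) (eᶜ + e′) Δ mᵘ eᵘ hole
             (xy∙z≈xz∙y mᶜ mᵘ m′) (xy∙z≈xz∙y eᶜ eᵘ e′)
             (splits-⊎ᶜ (splits-tail split)) (refill-es (wkC-injective C) d₂ split refill)

-- A substitution context does not touch the type: the hole has the type of
-- the whole term and can be refilled at any type.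
SubstFrame : SCtx k h → Ctx k → ℕ → ℕ → Tm h → LinTy → Set
SubstFrame S Γ m e u L =
  Frame (wkS S) Γ m e u L (λ Γᶜ mᶜ eᶜ Δ → ∀ {L′} → Refillable (wkS S) (plugS S) Γᶜ mᶜ eᶜ Δ L′ L′)

sframe : (S : SCtx k h) {Γ : Ctx k} {u : Tm h} → Γ ⊢[ m , e ] plugS S u ∶ L → SubstFrame S Γ m e u L
sframe ⟨⟩ d = frame 𝟎ᶜ 0 0 _ _ _ d refl refl splits-unit (λ dv _ → _ , splits-unit , dv)
sframe (S [ _ ]ˢ) (es {m′ = m′} {e′ = e′} d₁ d₂) with sframe S d₁
... | frame Γᶜ mᶜ eᶜ Δ mᵘ eᵘ hole refl refl split refill =
  frame (tail Γᶜ ⊎ᶜ _) (mᶜ + m′) (eᶜ + e′) Δ mᵘ eᵘ hole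
        (xy∙z≈xz∙y mᶜ mᵘ m′) (xy∙z≈xz∙y eᶜ eᵘ e′)
        (splits-⊎ᶜ (splits-tail split)) (λ {L′} → refill-es (wkS-injective S) d₂ split (refill {L′}))

-- Subject expansion

Expansion : Tm n → Tm n → ℕ → ℕ → Set
Expansion {n} s t δm δe =
  ∀ {Γ : Ctx n} {m e L} → Γ ⊢[ m , e ] s ∶ L →
  ∃ λ Γ′ → Γ′ ≋ Γ × Γ′ ⊢[ δm + m , δe + e ] t ∶ L

expansion-in-context : (C : CCtx n h) {u v : Tm h} {δm δe : ℕ} →
  Expansion u v δm δe → Expansion (plugC C u) (plugC C v) δm δe
expansion-in-context C {δm = δm} {δe} expand d with cframe C d
... | _ , frame Γᶜ mᶜ eᶜ Δ mᵘ eᵘ hole refl refl split refill with expand hole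
... | Δ′ , Δ′≋Δ , hole′ with refill hole′ (λ y _ → un Δ′≋Δ y)
... | Γ′ , split′ , d′ =
  Γ′ , splits-unique split split′ (un Δ′≋Δ ∘ wkC C) ,
  recount (x∙yz≈y∙xz mᶜ δm mᵘ) (x∙yz≈y∙xz eᶜ δe eᵘ) d′

-- Root m-step  S⟨λx.t⟩ s ↦ S⟨t[x←s]⟩: the ES typing t[x←s] becomes (fun)
-- on λx.t, refilled into S, followed by (app).
root-m : (S : SCtx n h) {t : Tm (suc h)} {s : Tm n} →
         Expansion (plugS S (t ⟦ rename (wkS S) s ⟧)) (app (plugS S (lam t)) s) 1 0
root-m S {s = s} d with sframe S d
... | frame Γᶜ mᶜ eᶜ _ _ _ (es {Γ = Δᵗ} {Π = Πˢ} {m = mᵗ} {e = eᵗ} {m′ = mˢ} {e′ = eˢ} dᵗ dˢ) refl refl split refill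
  with rename-inversionᴹ (wkS S) (wkS-injective S) s dˢ
... | Π₀ , dˢ₀ , restricts , empty with refill (fun dᵗ) agree
  where
  -- the argument's context lives inside the image of the weakening
  agree : Agree (wkS S) Δᵗ (Δᵗ ⊎ᶜ Πˢ)
  agree y off = ↭-reflexive (sym (begin
      lookup (Δᵗ ⊎ᶜ Πˢ) y       ≡⟨ lookup-⊎ᶜ Δᵗ Πˢ y ⟩
      lookup Δᵗ y ++ lookup Πˢ y ≡⟨ cong (lookup Δᵗ y ++_) (empty-at empty y off) ⟩
      lookup Δᵗ y ++ []          ≡⟨ ++-identityʳ (lookup Δᵗ y) ⟩
      lookup Δᵗ y                ∎))
    where open ≡-Reasoning
... | Γ′ , split′ , dλ =
  Γ′ ⊎ᶜ Π₀ , splits-unique split (splits-restricts split′ restricts) (λ _ → ↭-refl) ,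
  recount (cong suc (+-assoc mᶜ mᵗ mˢ)) (+-assoc eᶜ eᵗ eˢ) (app dλ dˢ₀)

-- Root e-step  C⟨⟨x⟩⟩[x←t] ↦ C⟨⟨t⟩⟩[x←t]: the derivation of the copy of t
-- joins the family typing the ES, and x is typed by an axiom instead.
root-e : (C : CCtx (suc n) h) {t : Tm n} →
         Expansion (plugC C (rename (wkC C ∘ suc) t) ⟦ t ⟧) (plugC C (var (wkC C zero)) ⟦ t ⟧) 0 1
root-e C {t} (es {Γ = Γ} {Π = Π} {m′ = m₂} {e′ = e₂} {M = M} d₁ d₂) with cframe C d₁
... | Lᵘ , frame Γᶜ mᶜ eᶜ Δ mᵘ eᵘ hole refl refl split refill
  with rename-inversion (wkC C ∘ suc) (suc-injective ∘ wkC-injective C) t hole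
... | Δ₀ , d₀ , restricts , empty with refill (ax (wkC C zero) Lᵘ) agree
  where
  agree : Agree (wkC C) (wkC C zero ∶ᶜ [ Lᵘ ]) Δ
  agree y off = ↭-reflexive (trans (lookup-∶ᶜ-other [ Lᵘ ] (off zero)) (sym (empty-at empty y (off ∘ suc))))
... | M′ ∷ Γ′ , split′ , dˣ with many-perm (d₀ ∷ d₂) (↭-gain old new)
  where
  x-unseen : OffImage (wkC C ∘ suc) (wkC C zero)
  x-unseen = zero-offImage (wkC-injective C)
  -- before the step x gets nothing from the hole, afterwards exactly Lᵘ
  old : M ↭ lookup Γᶜ zero
  old = ↭-trans (split-at split zero) (↭-reflexive
          (trans (cong (lookup Γᶜ zero ++_) (empty-at empty _ x-unseen)) (++-identityʳ _)))
  new : M′ ↭ lookup Γᶜ zero ++ [ Lᵘ ]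
  new = ↭-trans (split-at split′ zero) (↭-reflexive (cong (lookup Γᶜ zero ++_) (lookup-∶ᶜ-self (wkC C zero) [ Lᵘ ])))
... | Π′ , Π′≋Δ₀⊎Π , d₂′ =
  Γ′ ⊎ᶜ Π′ ,
  ≋-trans (⊎ᶜ-cong ≋-refl Π′≋Δ₀⊎Π) (≋-trans (⊎ᶜ-assoc Γ′ Δ₀ Π) (⊎ᶜ-cong Γ′⊎Δ₀≋Γ ≋-refl)) ,
  recount (m-count mᶜ mᵘ m₂) (e-count eᶜ eᵘ e₂) (es dˣ d₂′)
  where
  -- Γ′ keeps C's share of Γ; Δ₀ is the share the copy of t took from Γ
  Γ′⊎Δ₀≋Γ : (Γ′ ⊎ᶜ Δ₀) ≋ Γ
  Γ′⊎Δ₀≋Γ = splits-unique (splits-tail split) (splits-restricts (splits-tail split′) restricts)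
              (↭-reflexive ∘ ∶ᶜ-off-image [ Lᵘ ] Δ (zero-offImage (wkC-injective C)))
  m-count : ∀ a b c → (a + 0) + (b + c) ≡ 0 + ((a + b) + c)
  m-count = solve-∀
  e-count : ∀ a b c → (a + 1) + (b + c) ≡ 1 + ((a + b) + c)
  e-count = solve-∀

mutual
  ≈L-refl : (L : LinTy) → L ≈L L
  ≈L-refl normal  = normal
  ≈L-refl (M ⇒ L) = Homogeneous.refl (≈L-pointwise-refl M) ⇒ ≈L-refl L

  ≈L-pointwise-refl : (M : MultiTy) → ListPointwise.Pointwise _≈L_ M M
  ≈L-pointwise-refl []      = ListPointwise.[]
  ≈L-pointwise-refl (L ∷ M) = ≈L-refl L ListPointwise.∷ ≈L-pointwise-refl M

↭⇒≈M : {M M′ : MultiTy} → M ↭ M′ → M ≈M M′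
↭⇒≈M p = Homogeneous.map (λ { refl → ≈L-refl _ }) (↭⇒↭ₛ p)

≋⇒≈C : {Γ Γ′ : Ctx n} → Γ ≋ Γ′ → Γ ≈C Γ′
≋⇒≈C {Γ = []}    {[]}    _ = VecPointwise.[]
≋⇒≈C {Γ = _ ∷ _} {_ ∷ _} p = ↭⇒≈M (un p zero) VecPointwise.∷ ≋⇒≈C (mk≋ (un p ∘ suc))

frozen : {Γ : Ctx n} {t : Tm n} → (∃ λ Γ′ → Γ′ ≋ Γ × Γ′ ⊢[ m , e ] t ∶ L) →
         ∃₂ λ Γ′ L′ → Γ′ ≈C Γ × L′ ≈L L × Γ′ ⊢[ m , e ] t ∶ L′
frozen {L = L} (Γ′ , Γ′≋Γ , d) = Γ′ , L , ≋⇒≈C Γ′≋Γ , ≈L-refl L , d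

proposition5 : ∀ {n} {Γ : Ctx n} {m e : ℕ} {s : Tm n} {L : LinTy} →
    Γ ⊢[ m , e ] s ∶ L →
    (∀ {t : Tm n} → t →m-cbn s →
      ∃₂ λ Γ′ L′ → Γ′ ≈C Γ × L′ ≈L L × Γ′ ⊢[ suc m , e ] t ∶ L′)
    × (∀ {t : Tm n} → t →e-cbn s →
      ∃₂ λ Γ′ L′ → Γ′ ≈C Γ × L′ ≈L L × Γ′ ⊢[ m , suc e ] t ∶ L′)
proposition5 d =
  (λ { (ctx C (dB S _ _)) → frozen (expansion-in-context C (root-m S) d) }) ,
  (λ { (ctx C (ls C′ _))  → frozen (expansion-in-context C (root-e C′) d) })
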